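{- Let $G=(A\cup B,E)$ be a bipartite graph with strict preferences, with vertex weights $w(a)=c$ for all $a\in A$, where $c>3$, and $w(b)=1$ for all $b\in B$. Let $M_1$ and $M_2$ be popular matchings and $C$ a connected component of $M_1\triangle M_2$. Then every nice witness $\mathbf{y}$ of $M_1$ or of $M_2$ is, restricted to the vertices of $C$, either odd (all values $\mathbf{y}_v$, $v\in V(C)$, lie in $\{ -c,2-c,-1,1,c-2,c\}$) or even (all values $\mathbf{y}_v$, $v\in V(C)$, lie in $\{1-c,0,c-1\}$).
   Context: Every vertex has a strict preference order over its neighbours and prefers being matched to being unmatched. A matching $M$ is popular if for every matching $M'$, the total weight of vertices preferring $M$ to $M'$ is at least the total weight of vertices preferring $M'$ to $M$. For $u\in V$ and a neighbour $v$: $\mathsf{vote}^M_u(v)=0$ if $\{u,v\}\in M$; $=w(u)$ if $u$ is unmatched in $M$ or $u$ prefers $v$ to its partner in $M$; $=-w(u)$ otherwise; $\mathsf{vote}^M(\{u,v\})=\mathsf{vote}^M_u(v)+\mathsf{vote}^M_v(u)$. A witness of $M$ is $\mathbf{y}\in\mathbb{Q}^V$ with $\sum_v\mathbf{y}_v=0$, $\mathbf{y}_a+\mathbf{y}_b\ge\mathsf{vote}^M(\{a,b\})$ for all $\{a,b\}\in E$, $\mathbf{y}_v\ge0$ for $v$ unmatched in $M$, and $\mathbf{y}_v\ge-w(v)$ otherwise. A witness is nice if $\mathbf{y}_a\in\{ -c,1-c,2-c,-1,0,1\}$ for all $a\in A$ and $\mathbf{y}_b\in\{ -1,0,1,c-2,c-1,c\}$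 for all $b\in B$. -}

module Defs where

open import Data.Nat as ℕ using (ℕ; _<ᵇ_)
open import Data.Integer using (+_)
open import Data.Fin using (Fin; zero; suc)
open import Data.Fin.Properties using () renaming (_≟_ to _≟F_)
open import Data.Maybe using (Maybe; just; nothing)
open import Data.Sum using (_⊎_; inj₁; inj₂)
open import Data.Product using (∃; _×_)
open import Data.Bool using (if_then_else_)
open import Data.Rational using (ℚ; 0ℚ; 1ℚ; _+_; _-_; -_; _≤_; _<_; _/_)
open import Relation.Nullary using (yes; no; ¬_)
open import Relation.Binary.PropositionalEquality using (_≡_)

⟦_⟧ : ℕ → ℚ
⟦ n ⟧ = + n / 1

sumℚ : (n : ℕ) → (Fin n → ℚ) → ℚ
sumℚ ℕ.zero    f = 0ℚ
sumℚ (ℕ.suc n) f = f zero + sumℚ n (λ i → f (suc i))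

-- Preferences are given by ranks: u prefers v to v' iff rank u v < rank u v'.
record Graph (nA nB : ℕ) : Set₁ where
  field
    E      : Fin nA → Fin nB → Set
    rankA  : Fin nA → Fin nB → ℕ
    rankB  : Fin nB → Fin nA → ℕ
    strictA : ∀ a b b′ → E a b → E a b′ → rankA a b ≡ rankA a b′ → b ≡ b′
    strictB : ∀ b a a′ → E a b → E a′ b → rankB b a ≡ rankB b a′ → a ≡ a′
open Graph public

Vertex : ℕ → ℕ → Set
Vertex nA nB = Fin nA ⊎ Fin nB

record Matching {nA nB : ℕ} (G : Graph nA nB) : Set where
  field
    mA : Fin nA → Maybe (Fin nB)
    mB : Fin nB → Maybe (Fin nA)
    consAB : ∀ a b → mA a ≡ just b → mB b ≡ just a
    consBA : ∀ a b → mB b ≡ just a → mA a ≡ just b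
    inE    : ∀ a b → mA a ≡ just b → E G a b
open Matching public

cmp : {n : ℕ} → ℚ → (Fin n → ℕ) → Maybe (Fin n) → Maybe (Fin n) → ℚ
cmp w r nothing  nothing   = 0ℚ
cmp w r (just x) nothing   = w
cmp w r nothing  (just x′) = - w
cmp w r (just x) (just x′) with x ≟F x′
... | yes _ = 0ℚ
... | no  _ = if r x <ᵇ r x′ then w else - w

Δ : {nA nB : ℕ} (G : Graph nA nB) (c : ℚ) → Matching G → Matching G → ℚ
Δ {nA} {nB} G c M M′ =
  sumℚ nA (λ a → cmp c (rankA G a) (mA M a) (mA M′ a))
  + sumℚ nB (λ b → cmp 1ℚ (rankB G b) (mB M b) (mB M′ b))

Popular : {nA nB : ℕ} (G : Graph nA nB) (c : ℚ) → Matching G → Set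
Popular G c M = ∀ (M′ : Matching G) → 0ℚ ≤ Δ G c M M′

voteV : {n : ℕ} → ℚ → (Fin n → ℕ) → Maybe (Fin n) → Fin n → ℚ
voteV w r nothing  v = w
voteV w r (just p) v with p ≟F v
... | yes _ = 0ℚ
... | no  _ = if r v <ᵇ r p then w else - w

vote : {nA nB : ℕ} (G : Graph nA nB) (c : ℚ) → Matching G → Fin nA → Fin nB → ℚ
vote G c M a b = voteV c (rankA G a) (mA M a) b + voteV 1ℚ (rankB G b) (mB M b) a

record Witness {nA nB : ℕ} (G : Graph nA nB) (c : ℚ) (M : Matching G)
               (y : Vertex nA nB → ℚ) : Set where
  field
    sumZero  : sumℚ nA (λ a → y (inj₁ a)) + sumℚ nB (λ b → y (inj₂ b)) ≡ 0ℚ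
    edgeCov  : ∀ a b → E G a b → vote G c M a b ≤ y (inj₁ a) + y (inj₂ b)
    unmatchA : ∀ a → mA M a ≡ nothing → 0ℚ ≤ y (inj₁ a)
    unmatchB : ∀ b → mB M b ≡ nothing → 0ℚ ≤ y (inj₂ b)
    matchA   : ∀ a b → mA M a ≡ just b → - c ≤ y (inj₁ a)
    matchB   : ∀ a b → mB M b ≡ just a → - 1ℚ ≤ y (inj₂ b)

NiceA : ℚ → ℚ → Set
NiceA c x = x ≡ - c ⊎ x ≡ 1ℚ - c ⊎ x ≡ ⟦ 2 ⟧ - c ⊎ x ≡ - 1ℚ ⊎ x ≡ 0ℚ ⊎ x ≡ 1ℚ

NiceB : ℚ → ℚ → Set
NiceB c x = x ≡ - 1ℚ ⊎ x ≡ 0ℚ ⊎ x ≡ 1ℚ ⊎ x ≡ c - ⟦ 2 ⟧ ⊎ x ≡ c - 1ℚ ⊎ x ≡ c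

NiceWitness : {nA nB : ℕ} (G : Graph nA nB) (c : ℚ) (M : Matching G)
              (y : Vertex nA nB → ℚ) → Set
NiceWitness G c M y =
  Witness G c M y × (∀ a → NiceA c (y (inj₁ a))) × (∀ b → NiceB c (y (inj₂ b)))

OddVal : ℚ → ℚ → Set
OddVal c x = x ≡ - c ⊎ x ≡ ⟦ 2 ⟧ - c ⊎ x ≡ - 1ℚ ⊎ x ≡ 1ℚ ⊎ x ≡ c - ⟦ 2 ⟧ ⊎ x ≡ c

EvenVal : ℚ → ℚ → Set
EvenVal c x = x ≡ 1ℚ - c ⊎ x ≡ 0ℚ ⊎ x ≡ c - 1ℚ

SymDiff : {nA nB : ℕ} {G : Graph nA nB} → Matching G → Matching G → Fin nA → Fin nB → Set
SymDiff M₁ M₂ a b = (mA M₁ a ≡ just b × ¬ mA M₂ a ≡ just b)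
                  ⊎ (mA M₂ a ≡ just b × ¬ mA M₁ a ≡ just b)

data Reach {nA nB : ℕ} {G : Graph nA nB} (M₁ M₂ : Matching G) (u : Vertex nA nB)
     : Vertex nA nB → Set where
  here : Reach M₁ M₂ u u
  stepAB : ∀ a b → Reach M₁ M₂ u (inj₁ a) → SymDiff M₁ M₂ a b → Reach M₁ M₂ u (inj₂ b)
  stepBA : ∀ a b → Reach M₁ M₂ u (inj₂ b) → SymDiff M₁ M₂ a b → Reach M₁ M₂ u (inj₁ a)

-- Every edge of M₁ △ M₂ is tight for y. Summing the witness constraints along a matching N
-- gives -Δ(N, M), the total of nonnegative slacks; so along M itself (Δ = 0) and along a popular
-- N (Δ ≥ 0) every slack vanishes, i.e. y_a + y_b = vote^M(a, b), which is 0 on M and ±c ± 1 off M.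
-- Write nice values and votes as affine forms p + q·c. The odd values are exactly those with
-- p + q odd (the parity at c = 1), while every vote has p + q even. For a nice A-value, a nice
-- B-value of the other parity and a vote, the form y_a + y_b - vote has no root c > 3 (a finite
-- check); so both ends of an edge have the same parity, which is thus constant on a component.

module Submission where

open import Defs
open import Data.Bool using (Bool; true; false; T; if_then_else_)
open import Data.Bool.ListAction using (all)
open import Data.Empty using (⊥-elim)
open import Data.Fin using (Fin; zero; suc)
open import Data.Fin.Properties using (_≟_)
open import Data.List using (List; []; _∷_)
open import Data.List.Membership.Propositional using (_∈_; find)
open import Data.List.Relation.Unary.All as All using ()
open import Data.List.Relation.Unary.All.Properties using (all⁺)
open import Data.List.Relation.Unary.Any as Any using (Any; here; there)
open import Data.Maybe using (Maybe; just; nothing; maybe′)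
open import Data.Maybe.Properties using (≡-dec)
open import Data.Nat using (ℕ; _<ᵇ_)
open import Data.Unit using (tt)
open import Data.Product using (_×_; _,_; proj₁)
open import Data.Rational using (ℚ; 0ℚ; 1ℚ; _+_; _-_; -_; _*_; _≤_; _<_; positive; negative)
open import Data.Rational.Properties
  using (≤-refl; ≤-trans; ≤-antisym; ≤-reflexive; <⇒≢; ≤-<-trans; <-≤-trans; _≤?_; _<?_;
         +-assoc; +-identityˡ; +-identityʳ; +-inverseʳ; +-mono-≤; +-monoˡ-≤; +-monoʳ-≤; +-monoʳ-<; *-zeroˡ;
         *-monoʳ-<-pos; *-monoʳ-<-neg; neg-antimono-≤)
  renaming (_≟_ to _≟ℚ_)
open import Data.Rational.Solver using (module +-*-Solver)
open +-*-Solver using (solve; _:=_; _:+_; _:*_; _:-_; :-_; con)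
open import Data.Sum using (_⊎_; inj₁; inj₂; swap) renaming (map to ⊎-map)
open import Function using (_∘_; const)
open import Relation.Nullary using (Dec; yes; no; ¬_; ¬?; does; isYes)
open import Relation.Nullary.Decidable using (_×-dec_; _⊎-dec_; toWitness; dec-true; dec-false)
open import Relation.Binary.PropositionalEquality

p≤q⇒0≤q-p : ∀ {p q} → p ≤ q → 0ℚ ≤ q - p
p≤q⇒0≤q-p {p} {q} p≤q = subst (_≤ q - p) (+-inverseʳ p) (+-monoˡ-≤ (- p) p≤q)

p-q≤0⇒p≤q : ∀ {p q} → p - q ≤ 0ℚ → p ≤ q
p-q≤0⇒p≤q {p} {q} p-q≤0 =
  subst₂ _≤_ (solve 2 (λ p q → (p :- q) :+ q := p) refl p q) (+-identityˡ q) (+-monoˡ-≤ q p-q≤0)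

sumℚ-cong : ∀ n {f g : Fin n → ℚ} → (∀ i → f i ≡ g i) → sumℚ n f ≡ sumℚ n g
sumℚ-cong ℕ.zero    f≗g = refl
sumℚ-cong (ℕ.suc n) f≗g = cong₂ _+_ (f≗g zero) (sumℚ-cong n (f≗g ∘ suc))

sumℚ-0 : ∀ n → sumℚ n (const 0ℚ) ≡ 0ℚ
sumℚ-0 ℕ.zero    = refl
sumℚ-0 (ℕ.suc n) = trans (+-identityˡ _) (sumℚ-0 n)

sumℚ-distrib-+ : ∀ n (f g : Fin n → ℚ) → sumℚ n (λ i → f i + g i) ≡ sumℚ n f + sumℚ n g
sumℚ-distrib-+ ℕ.zero    f g = refl
sumℚ-distrib-+ (ℕ.suc n) f g =
  trans (cong (f zero + g zero +_) (sumℚ-distrib-+ n (f ∘ suc) (g ∘ suc)))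
        (solve 4 (λ x y u v → (x :+ y) :+ (u :+ v) := (x :+ u) :+ (y :+ v)) refl (f zero) (g zero) _ _)

sumℚ-distrib-- : ∀ n (f g : Fin n → ℚ) → sumℚ n (λ i → f i - g i) ≡ sumℚ n f - sumℚ n g
sumℚ-distrib-- ℕ.zero    f g = refl
sumℚ-distrib-- (ℕ.suc n) f g =
  trans (cong (f zero - g zero +_) (sumℚ-distrib-- n (f ∘ suc) (g ∘ suc)))
        (solve 4 (λ x y u v → (x :- y) :+ (u :- v) := (x :+ u) :- (y :+ v)) refl (f zero) (g zero) _ _)

sumℚ-comm : ∀ n m (F : Fin n → Fin m → ℚ) →
            sumℚ n (λ i → sumℚ m (F i)) ≡ sumℚ m (λ j → sumℚ n (λ i → F i j))
sumℚ-comm ℕ.zero    m F = sym (sumℚ-0 m)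
sumℚ-comm (ℕ.suc n) m F = trans (cong (sumℚ m (F zero) +_) (sumℚ-comm n m (F ∘ suc)))
                                (sym (sumℚ-distrib-+ m (F zero) _))

sumℚ-nonneg : ∀ n (f : Fin n → ℚ) → (∀ i → 0ℚ ≤ f i) → 0ℚ ≤ sumℚ n f
sumℚ-nonneg ℕ.zero    f 0≤f = ≤-refl
sumℚ-nonneg (ℕ.suc n) f 0≤f = +-mono-≤ (0≤f zero) (sumℚ-nonneg n (f ∘ suc) (0≤f ∘ suc))

term≤sumℚ : ∀ n (f : Fin n → ℚ) → (∀ i → 0ℚ ≤ f i) → ∀ i → f i ≤ sumℚ n f
term≤sumℚ (ℕ.suc n) f 0≤f zero =
  subst (_≤ sumℚ (ℕ.suc n) f) (+-identityʳ (f zero))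
        (+-monoʳ-≤ (f zero) (sumℚ-nonneg n (f ∘ suc) (0≤f ∘ suc)))
term≤sumℚ (ℕ.suc n) f 0≤f (suc i) =
  subst (_≤ sumℚ (ℕ.suc n) f) (+-identityˡ (f (suc i)))
        (+-mono-≤ (0≤f zero) (term≤sumℚ n (f ∘ suc) (0≤f ∘ suc) i))

pick : ∀ {n} → Maybe (Fin n) → Fin n → ℚ → ℚ
pick p i v = if does (≡-dec _≟_ p (just i)) then v else 0ℚ

pick-just : ∀ {n} {p : Maybe (Fin n)} {i} v → p ≡ just i → pick p i v ≡ v
pick-just {p = p} {i} v p≡i = cong (if_then v else 0ℚ) (dec-true (≡-dec _≟_ p (just i)) p≡i)

pick-¬just : ∀ {n} {p : Maybe (Fin n)} {i} v → ¬ p ≡ just i → pick p i v ≡ 0ℚ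
pick-¬just {p = p} {i} v p≢i = cong (if_then v else 0ℚ) (dec-false (≡-dec _≟_ p (just i)) p≢i)

sumℚ-pick : ∀ n p (f : Fin n → ℚ) → sumℚ n (λ i → pick p i (f i)) ≡ maybe′ f 0ℚ p
sumℚ-pick n         nothing        f = sumℚ-0 n
sumℚ-pick (ℕ.suc n) (just zero)    f = trans (cong (f zero +_) (sumℚ-0 n)) (+-identityʳ (f zero))
sumℚ-pick (ℕ.suc n) (just (suc j)) f = trans (+-identityˡ _) (sumℚ-pick n (just j) (f ∘ suc))

module _ {nA nB : ℕ} {G : Graph nA nB} (M : Matching G) where

  pick-partner : ∀ a b v → pick (mA M a) b v ≡ pick (mB M b) a v
  pick-partner a b v = by-cases (≡-dec _≟_ (mA M a) (just b))
    where
    by-cases : Dec (mA M a ≡ just b) → pick (mA M a) b v ≡ pick (mB M b) a v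
    by-cases (yes a↦b) = trans (pick-just v a↦b) (sym (pick-just v (consAB M a b a↦b)))
    by-cases (no  a↛b) = trans (pick-¬just v a↛b) (sym (pick-¬just v (a↛b ∘ consBA M a b)))

  sumℚ-partners : (k : Fin nB → ℚ) →
    sumℚ nA (λ a → maybe′ k 0ℚ (mA M a)) ≡ sumℚ nB (λ b → maybe′ (const (k b)) 0ℚ (mB M b))
  sumℚ-partners k = begin
    sumℚ nA (λ a → maybe′ k 0ℚ (mA M a))
      ≡⟨ sumℚ-cong nA (λ a → sym (sumℚ-pick nB (mA M a) k)) ⟩
    sumℚ nA (λ a → sumℚ nB (λ b → pick (mA M a) b (k b)))
      ≡⟨ sumℚ-cong nA (λ a → sumℚ-cong nB (λ b → pick-partner a b (k b))) ⟩
    sumℚ nA (λ a → sumℚ nB (λ b → pick (mB M b) a (k b)))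
      ≡⟨ sumℚ-comm nA nB _ ⟩
    sumℚ nB (λ b → sumℚ nA (λ a → pick (mB M b) a (k b)))
      ≡⟨ sumℚ-cong nB (λ b → sumℚ-pick nA (mB M b) (const (k b))) ⟩
    sumℚ nB (λ b → maybe′ (const (k b)) 0ℚ (mB M b)) ∎
    where open ≡-Reasoning

  sumℚ-pairing : (φ : Fin nA → ℚ) (k : Fin nB → ℚ) →
    sumℚ nA (λ a → φ a + maybe′ k 0ℚ (mA M a)) + sumℚ nB (λ b → maybe′ (const 0ℚ) (k b) (mB M b))
    ≡ sumℚ nA φ + sumℚ nB k
  sumℚ-pairing φ k = begin
    sumℚ nA (λ a → φ a + maybe′ k 0ℚ (mA M a)) + U
      ≡⟨ cong (_+ U) (sumℚ-distrib-+ nA φ _) ⟩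
    (sumℚ nA φ + sumℚ nA (λ a → maybe′ k 0ℚ (mA M a))) + U
      ≡⟨ cong (λ m → (sumℚ nA φ + m) + U) (sumℚ-partners k) ⟩
    (sumℚ nA φ + sumℚ nB matched) + U
      ≡⟨ +-assoc (sumℚ nA φ) _ U ⟩
    sumℚ nA φ + (sumℚ nB matched + U)
      ≡⟨ cong (sumℚ nA φ +_) (sym (sumℚ-distrib-+ nB matched _)) ⟩
    sumℚ nA φ + sumℚ nB (λ b → matched b + unmatched b)
      ≡⟨ cong (sumℚ nA φ +_) (sumℚ-cong nB (λ b → split (mB M b))) ⟩
    sumℚ nA φ + sumℚ nB k ∎
    where
    open ≡-Reasoning
    matched unmatched : Fin nB → ℚ
    matched b = maybe′ (const (k b)) 0ℚ (mB M b)
    unmatched b = maybe′ (const 0ℚ) (k b) (mB M b)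
    U : ℚ
    U = sumℚ nB unmatched
    split : ∀ {b} p → maybe′ (const (k b)) 0ℚ p + maybe′ (const 0ℚ) (k b) p ≡ k b
    split nothing  = +-identityˡ _
    split (just _) = +-identityʳ _

  pairing-term≤sum : (φ : Fin nA → ℚ) (k : Fin nB → ℚ) →
    (∀ a → 0ℚ ≤ φ a + maybe′ k 0ℚ (mA M a)) → (∀ b → 0ℚ ≤ maybe′ (const 0ℚ) (k b) (mB M b)) →
    ∀ a → φ a + maybe′ k 0ℚ (mA M a) ≤ sumℚ nA φ + sumℚ nB k
  pairing-term≤sum φ k 0≤termA 0≤termB a = begin
    φ a + maybe′ k 0ℚ (mA M a)
      ≤⟨ term≤sumℚ nA _ 0≤termA a ⟩
    sumℚ nA _
      ≡⟨ sym (+-identityʳ _) ⟩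
    sumℚ nA _ + 0ℚ
      ≤⟨ +-monoʳ-≤ (sumℚ nA _) (sumℚ-nonneg nB _ 0≤termB) ⟩
    sumℚ nA _ + sumℚ nB _
      ≡⟨ sumℚ-pairing φ k ⟩
    sumℚ nA φ + sumℚ nB k ∎
    where open Data.Rational.Properties.≤-Reasoning

cmp-refl : ∀ {n} w (r : Fin n → ℕ) p → cmp w r p p ≡ 0ℚ
cmp-refl w r nothing = refl
cmp-refl w r (just x) with x ≟ x
... | yes _   = refl
... | no  x≢x = ⊥-elim (x≢x refl)

Δ-refl : ∀ {nA nB} (G : Graph nA nB) c (M : Matching G) → Δ G c M M ≡ 0ℚ
Δ-refl {nA} {nB} G c M =
  cong₂ _+_ (trans (sumℚ-cong nA (λ a → cmp-refl c (rankA G a) (mA M a))) (sumℚ-0 nA))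
            (trans (sumℚ-cong nB (λ b → cmp-refl 1ℚ (rankB G b) (mB M b))) (sumℚ-0 nB))

cmp-just : ∀ {n} w (r : Fin n → ℕ) x p → cmp w r (just x) p ≡ voteV w r p x
cmp-just w r x nothing = refl
cmp-just w r x (just x′) with x ≟ x′ | x′ ≟ x
... | yes _    | yes _ = refl
... | no  _    | no  _ = refl
... | yes refl | no x≢x = ⊥-elim (x≢x refl)
... | no x≢x   | yes refl = ⊥-elim (x≢x refl)

unmatched-slack : ∀ {n} w (r : Fin n → ℕ) {p′ p x} → p′ ≡ nothing →
                  (p ≡ nothing → 0ℚ ≤ x) → (∀ q → p ≡ just q → - w ≤ x) → 0ℚ ≤ x - cmp w r p′ p
unmatched-slack w r {p = nothing} refl 0≤x -w≤x = p≤q⇒0≤q-p (0≤x refl)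
unmatched-slack w r {p = just q}  refl 0≤x -w≤x = p≤q⇒0≤q-p (-w≤x q refl)

voteV-partner : ∀ {n} w (r : Fin n → ℕ) x → voteV w r (just x) x ≡ 0ℚ
voteV-partner w r x with x ≟ x
... | yes _   = refl
... | no  x≢x = ⊥-elim (x≢x refl)

voteV-± : ∀ {n} w (r : Fin n → ℕ) p v → ¬ p ≡ just v → voteV w r p v ≡ w ⊎ voteV w r p v ≡ - w
voteV-± w r nothing  v _ = inj₁ refl
voteV-± w r (just x) v x≢v with x ≟ v
... | yes refl = ⊥-elim (x≢v refl)
... | no  _ with r v <ᵇ r x
...   | true  = inj₁ refl
...   | false = inj₂ refl

infix 6 _+_·c

record Affine : Set where
  constructor _+_·c
  field
    intercept slope : ℚ
open Affine

⟪_⟫ : Affine → ℚ → ℚ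
⟪ p + q ·c ⟫ c = p + q * c

_+ᵃ_-ᵃ_ : Affine → Affine → Affine → Affine
(p + q ·c) +ᵃ (p′ + q′ ·c) -ᵃ (p″ + q″ ·c) = ((p + p′) - p″) + ((q + q′) - q″) ·c

⟪+ᵃ-ᵃ⟫ : ∀ f g h c → ⟪ f +ᵃ g -ᵃ h ⟫ c ≡ (⟪ f ⟫ c + ⟪ g ⟫ c) - ⟪ h ⟫ c
⟪+ᵃ-ᵃ⟫ (p + q ·c) (p′ + q′ ·c) (p″ + q″ ·c) = solve 7
  (λ p q p′ q′ p″ q″ c → ((p :+ p′) :- p″) :+ ((q :+ q′) :- q″) :* c
                       := ((p :+ q :* c) :+ (p′ :+ q′ :* c)) :- (p″ :+ q″ :* c))
  refl p q p′ q′ p″ q″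

NoRootAbove : ℚ → Affine → Set
NoRootAbove d f = (slope f ≡ 0ℚ × intercept f ≢ 0ℚ)
                ⊎ (0ℚ < slope f × 0ℚ ≤ ⟪ f ⟫ d)
                ⊎ (slope f < 0ℚ × ⟪ f ⟫ d ≤ 0ℚ)

noRootAbove? : ∀ d f → Dec (NoRootAbove d f)
noRootAbove? d f = (slope f ≟ℚ 0ℚ ×-dec ¬? (intercept f ≟ℚ 0ℚ))
                ⊎-dec (0ℚ <? slope f ×-dec 0ℚ ≤? ⟪ f ⟫ d)
                ⊎-dec (slope f <? 0ℚ ×-dec ⟪ f ⟫ d ≤? 0ℚ)

noRootAbove⇒≢0 : ∀ {d c} f → NoRootAbove d f → d < c → ⟪ f ⟫ c ≢ 0ℚ
noRootAbove⇒≢0 {c = c} (p + q ·c) (inj₁ (refl , p≢0)) _ fc≡0 =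
  p≢0 (trans (sym (trans (cong (p +_) (*-zeroˡ c)) (+-identityʳ p))) fc≡0)
noRootAbove⇒≢0 (p + q ·c) (inj₂ (inj₁ (0<q , 0≤fd))) d<c fc≡0 =
  <⇒≢ (≤-<-trans 0≤fd (+-monoʳ-< p (*-monoʳ-<-pos q {{positive 0<q}} d<c))) (sym fc≡0)
noRootAbove⇒≢0 (p + q ·c) (inj₂ (inj₂ (q<0 , fd≤0))) d<c fc≡0 =
  <⇒≢ (<-≤-trans (+-monoʳ-< p (*-monoʳ-<-neg q {{negative q<0}} d<c)) fd≤0) fc≡0

voteValues : List Affine
voteValues = 0ℚ + 0ℚ ·c ∷ 1ℚ + 1ℚ ·c ∷ - 1ℚ + 1ℚ ·c ∷ 1ℚ + - 1ℚ ·c ∷ - 1ℚ + - 1ℚ ·c ∷ []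

VoteValuedSum : ∀ {nA nB} → ℚ → (Vertex nA nB → ℚ) → Fin nA → Fin nB → Set
VoteValuedSum c y a b = Any (λ s → y (inj₁ a) + y (inj₂ b) ≡ ⟪ s ⟫ c) voteValues

±c±1∈voteValues : ∀ {c x y} → x ≡ c ⊎ x ≡ - c → y ≡ 1ℚ ⊎ y ≡ - 1ℚ →
                  Any (λ s → x + y ≡ ⟪ s ⟫ c) voteValues
±c±1∈voteValues {c} (inj₁ refl) (inj₁ refl) =
  there (here (solve 1 (λ c → c :+ con 1ℚ := con 1ℚ :+ con 1ℚ :* c) refl c))
±c±1∈voteValues {c} (inj₁ refl) (inj₂ refl) =
  there (there (here (solve 1 (λ c → c :+ con (- 1ℚ) := con (- 1ℚ) :+ con 1ℚ :* c) refl c)))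
±c±1∈voteValues {c} (inj₂ refl) (inj₁ refl) =
  there (there (there (here (solve 1 (λ c → :- c :+ con 1ℚ := con 1ℚ :+ con (- 1ℚ) :* c) refl c))))
±c±1∈voteValues {c} (inj₂ refl) (inj₂ refl) =
  there (there (there (there (here
    (solve 1 (λ c → :- c :+ con (- 1ℚ) := con (- 1ℚ) :+ con (- 1ℚ) :* c) refl c)))))

module _ {nA nB : ℕ} {G : Graph nA nB} (c : ℚ) (M : Matching G) where

  vote-partner : ∀ a b → mA M a ≡ just b → vote G c M a b ≡ 0ℚ
  vote-partner a b a↦b rewrite a↦b | consAB M a b a↦b =
    cong₂ _+_ (voteV-partner c (rankA G a) b) (voteV-partner 1ℚ (rankB G b) a)

  vote∈voteValues : ∀ a b → Any (λ s → vote G c M a b ≡ ⟪ s ⟫ c) voteValues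
  vote∈voteValues a b = by-cases (≡-dec _≟_ (mA M a) (just b))
    where
    by-cases : Dec (mA M a ≡ just b) → Any (λ s → vote G c M a b ≡ ⟪ s ⟫ c) voteValues
    by-cases (yes a↦b) =
      here (trans (vote-partner a b a↦b) (solve 1 (λ c → con 0ℚ := con 0ℚ :+ con 0ℚ :* c) refl c))
    by-cases (no a↛b) = ±c±1∈voteValues (voteV-± c (rankA G a) (mA M a) b a↛b)
                                         (voteV-± 1ℚ (rankB G b) (mB M b) a (a↛b ∘ consBA M a b))

module _ {nA nB : ℕ} {G : Graph nA nB} {c : ℚ} {M : Matching G} {y : Vertex nA nB → ℚ}
         (W : Witness G c M y) where

  open Witness W

  -- Along a matching N the witness constraints have nonnegative slacks which add up to -Δ(N, M).
  edge-slack≤-Δ : (N : Matching G) → ∀ {a₀ b₀} → mA N a₀ ≡ just b₀ →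
                  (y (inj₁ a₀) + y (inj₂ b₀)) - vote G c M a₀ b₀ ≤ - Δ G c N M
  edge-slack≤-Δ N {a₀} {b₀} a₀↦b₀ = begin
    (y (inj₁ a₀) + y (inj₂ b₀)) - vote G c M a₀ b₀
      ≡⟨ sym (edge-slack a₀↦b₀) ⟩
    φ a₀ + k b₀
      ≡⟨ cong (λ p → φ a₀ + maybe′ k 0ℚ p) (sym a₀↦b₀) ⟩
    φ a₀ + maybe′ k 0ℚ (mA N a₀)
      ≤⟨ pairing-term≤sum N φ k slackA slackB a₀ ⟩
    sumℚ nA φ + sumℚ nB k
      ≡⟨ total ⟩
    - Δ G c N M ∎
    where
    open Data.Rational.Properties.≤-Reasoning
    φ : Fin nA → ℚ
    φ a = y (inj₁ a) - cmp c (rankA G a) (mA N a) (mA M a)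
    k : Fin nB → ℚ
    k b = y (inj₂ b) - cmp 1ℚ (rankB G b) (mB N b) (mB M b)

    edge-slack : ∀ {a b} → mA N a ≡ just b → φ a + k b ≡ (y (inj₁ a) + y (inj₂ b)) - vote G c M a b
    edge-slack {a} {b} a↦b
      rewrite a↦b | consAB N a b a↦b
            | cmp-just c (rankA G a) b (mA M a) | cmp-just 1ℚ (rankB G b) a (mB M b) =
      solve 4 (λ x u z v → (x :- u) :+ (z :- v) := (x :+ z) :- (u :+ v)) refl (y (inj₁ a)) _ (y (inj₂ b)) _

    slackA : ∀ a → 0ℚ ≤ φ a + maybe′ k 0ℚ (mA N a)
    slackA a = by-cases (mA N a) refl
      where
      by-cases : ∀ p → mA N a ≡ p → 0ℚ ≤ φ a + maybe′ k 0ℚ p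
      by-cases (just b) a↦b = subst (0ℚ ≤_) (sym (edge-slack a↦b)) (p≤q⇒0≤q-p (edgeCov a b (inE N a b a↦b)))
      by-cases nothing  a↛  = subst (0ℚ ≤_) (sym (+-identityʳ (φ a)))
                                    (unmatched-slack c (rankA G a) a↛ (unmatchA a) (matchA a))

    slackB : ∀ b → 0ℚ ≤ maybe′ (const 0ℚ) (k b) (mB N b)
    slackB b = by-cases (mB N b) refl
      where
      by-cases : ∀ p → mB N b ≡ p → 0ℚ ≤ maybe′ (const 0ℚ) (k b) p
      by-cases (just _) _  = ≤-refl
      by-cases nothing  b↛ = unmatched-slack 1ℚ (rankB G b) b↛ (unmatchB b) (λ a → matchB a b)

    total : sumℚ nA φ + sumℚ nB k ≡ - Δ G c N M
    total = begin-equality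
      sumℚ nA φ + sumℚ nB k
        ≡⟨ cong₂ _+_ (sumℚ-distrib-- nA _ _) (sumℚ-distrib-- nB _ _) ⟩
      (Y₁ - sumℚ nA _) + (Y₂ - sumℚ nB _)
        ≡⟨ solve 4 (λ x u z v → (x :- u) :+ (z :- v) := (x :+ z) :- (u :+ v)) refl Y₁ _ Y₂ _ ⟩
      (Y₁ + Y₂) - Δ G c N M
        ≡⟨ cong (_- Δ G c N M) sumZero ⟩
      0ℚ - Δ G c N M
        ≡⟨ +-identityˡ _ ⟩
      - Δ G c N M ∎
      where
      Y₁ Y₂ : ℚ
      Y₁ = sumℚ nA (λ a → y (inj₁ a))
      Y₂ = sumℚ nB (λ b → y (inj₂ b))

  tight-edge : (N : Matching G) → 0ℚ ≤ Δ G c N M → ∀ {a b} → mA N a ≡ just b →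
               y (inj₁ a) + y (inj₂ b) ≡ vote G c M a b
  tight-edge N 0≤Δ {a} {b} a↦b = ≤-antisym
    (p-q≤0⇒p≤q (≤-trans (edge-slack≤-Δ N a↦b) (neg-antimono-≤ 0≤Δ)))
    (edgeCov a b (inE N a b a↦b))

  tight-on-union : (N : Matching G) → Popular G c N → ∀ {a b} → mA M a ≡ just b ⊎ mA N a ≡ just b →
                   VoteValuedSum c y a b
  tight-on-union N popN {a} {b} matched = Any.map (trans (tight matched)) (vote∈voteValues c M a b)
    where
    tight : mA M a ≡ just b ⊎ mA N a ≡ just b → y (inj₁ a) + y (inj₂ b) ≡ vote G c M a b
    tight (inj₁ a↦b) = tight-edge M (≤-reflexive (sym (Δ-refl G c M))) a↦b
    tight (inj₂ a↦b) = tight-edge N (popN M) a↦b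

data Level : Set where
  [-c] [1-c] [2-c] [-1] [0] [1] [c-2] [c-1] [c] : Level

value : ℚ → Level → ℚ
value c [-c]  = - c
value c [1-c] = 1ℚ - c
value c [2-c] = ⟦ 2 ⟧ - c
value c [-1]  = - 1ℚ
value c [0]   = 0ℚ
value c [1]   = 1ℚ
value c [c-2] = c - ⟦ 2 ⟧
value c [c-1] = c - 1ℚ
value c [c]   = c

affine : Level → Affine
affine [-c]  = 0ℚ + - 1ℚ ·c
affine [1-c] = 1ℚ + - 1ℚ ·c
affine [2-c] = ⟦ 2 ⟧ + - 1ℚ ·c
affine [-1]  = - 1ℚ + 0ℚ ·c
affine [0]   = 0ℚ + 0ℚ ·c
affine [1]   = 1ℚ + 0ℚ ·c
affine [c-2] = - ⟦ 2 ⟧ + 1ℚ ·c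
affine [c-1] = - 1ℚ + 1ℚ ·c
affine [c]   = 0ℚ + 1ℚ ·c

value≡⟪affine⟫ : ∀ c t → value c t ≡ ⟪ affine t ⟫ c
value≡⟪affine⟫ c [-c]  = solve 1 (λ c → :- c := con 0ℚ :+ con (- 1ℚ) :* c) refl c
value≡⟪affine⟫ c [1-c] = solve 1 (λ c → con 1ℚ :- c := con 1ℚ :+ con (- 1ℚ) :* c) refl c
value≡⟪affine⟫ c [2-c] = solve 1 (λ c → con ⟦ 2 ⟧ :- c := con ⟦ 2 ⟧ :+ con (- 1ℚ) :* c) refl c
value≡⟪affine⟫ c [-1]  = solve 1 (λ c → con (- 1ℚ) := con (- 1ℚ) :+ con 0ℚ :* c) refl c
value≡⟪affine⟫ c [0]   = solve 1 (λ c → con 0ℚ := con 0ℚ :+ con 0ℚ :* c) refl c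
value≡⟪affine⟫ c [1]   = solve 1 (λ c → con 1ℚ := con 1ℚ :+ con 0ℚ :* c) refl c
value≡⟪affine⟫ c [c-2] = solve 1 (λ c → c :- con ⟦ 2 ⟧ := con (- ⟦ 2 ⟧) :+ con 1ℚ :* c) refl c
value≡⟪affine⟫ c [c-1] = solve 1 (λ c → c :- con 1ℚ := con (- 1ℚ) :+ con 1ℚ :* c) refl c
value≡⟪affine⟫ c [c]   = solve 1 (λ c → c := con 0ℚ :+ con 1ℚ :* c) refl c

data Parity : Set where
  odd even : Parity

_≟ᴾ_ : (p q : Parity) → Dec (p ≡ q)
odd  ≟ᴾ odd  = yes refl
odd  ≟ᴾ even = no λ ()
even ≟ᴾ odd  = no λ ()
even ≟ᴾ even = yes refl

parity : Level → Parity
parity [1-c] = even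
parity [0]   = even
parity [c-1] = even
parity _     = odd

Class : Parity → ℚ → ℚ → Set
Class odd  = OddVal
Class even = EvenVal

value-class : ∀ c t → Class (parity t) c (value c t)
value-class c [-c]  = inj₁ refl
value-class c [1-c] = inj₁ refl
value-class c [2-c] = inj₂ (inj₁ refl)
value-class c [-1]  = inj₂ (inj₂ (inj₁ refl))
value-class c [0]   = inj₂ (inj₁ refl)
value-class c [1]   = inj₂ (inj₂ (inj₂ (inj₁ refl)))
value-class c [c-2] = inj₂ (inj₂ (inj₂ (inj₂ (inj₁ refl))))
value-class c [c-1] = inj₂ (inj₂ refl)
value-class c [c]   = inj₂ (inj₂ (inj₂ (inj₂ (inj₂ refl))))

levelsA levelsB : List Level
levelsA = [-c] ∷ [1-c] ∷ [2-c] ∷ [-1] ∷ [0] ∷ [1] ∷ []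
levelsB = [-1] ∷ [0] ∷ [1] ∷ [c-2] ∷ [c-1] ∷ [c] ∷ []

niceA-level : ∀ {c x} → NiceA c x → Any (λ t → x ≡ value c t) levelsA
niceA-level (inj₁ e)                                   = here e
niceA-level (inj₂ (inj₁ e))                            = there (here e)
niceA-level (inj₂ (inj₂ (inj₁ e)))                     = there (there (here e))
niceA-level (inj₂ (inj₂ (inj₂ (inj₁ e))))              = there (there (there (here e)))
niceA-level (inj₂ (inj₂ (inj₂ (inj₂ (inj₁ e)))))       = there (there (there (there (here e))))
niceA-level (inj₂ (inj₂ (inj₂ (inj₂ (inj₂ e)))))       = there (there (there (there (there (here e)))))

niceB-level : ∀ {c x} → NiceB c x → Any (λ t → x ≡ value c t) levelsB
niceB-level (inj₁ e)                                   = here e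
niceB-level (inj₂ (inj₁ e))                            = there (here e)
niceB-level (inj₂ (inj₂ (inj₁ e)))                     = there (there (here e))
niceB-level (inj₂ (inj₂ (inj₂ (inj₁ e))))              = there (there (there (here e)))
niceB-level (inj₂ (inj₂ (inj₂ (inj₂ (inj₁ e)))))       = there (there (there (there (here e))))
niceB-level (inj₂ (inj₂ (inj₂ (inj₂ (inj₂ e)))))       = there (there (there (there (there (here e)))))

-- Pairs of two A-levels would fail: (2-c) + (1-c) = -c-1 at c = 4.
EdgeParity : Level → Level → Affine → Set
EdgeParity t₁ t₂ s = parity t₁ ≡ parity t₂ ⊎ NoRootAbove ⟦ 3 ⟧ (affine t₁ +ᵃ affine t₂ -ᵃ s)

edgeParity? : ∀ t₁ t₂ s → Dec (EdgeParity t₁ t₂ s)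
edgeParity? t₁ t₂ s = (parity t₁ ≟ᴾ parity t₂) ⊎-dec noRootAbove? ⟦ 3 ⟧ (affine t₁ +ᵃ affine t₂ -ᵃ s)

edgeParityᵇ : Level → Level → Affine → Bool
edgeParityᵇ t₁ t₂ s = isYes (edgeParity? t₁ t₂ s)

edgeParity-table : T (all (λ t₁ → all (λ t₂ → all (edgeParityᵇ t₁ t₂) voteValues) levelsB) levelsA)
edgeParity-table = tt

T-all-lookup : ∀ {A : Set} (p : A → Bool) xs {x} → T (all p xs) → x ∈ xs → T (p x)
T-all-lookup p xs all-p = All.lookup (all⁺ p xs all-p)

edgeParity-holds : ∀ {t₁ t₂ s} → t₁ ∈ levelsA → t₂ ∈ levelsB → s ∈ voteValues → EdgeParity t₁ t₂ s
edgeParity-holds {t₁} {t₂} {s} t₁∈ t₂∈ s∈ = toWitness {a? = edgeParity? t₁ t₂ s}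
  (T-all-lookup (edgeParityᵇ t₁ t₂) voteValues
    (T-all-lookup (λ t₂ → all (edgeParityᵇ t₁ t₂) voteValues) levelsB
      (T-all-lookup (λ t₁ → all (λ t₂ → all (edgeParityᵇ t₁ t₂) voteValues) levelsB) levelsA
        edgeParity-table t₁∈) t₂∈) s∈)

EdgeParity⇒≡parity : ∀ {c t₁ t₂ s} → ⟦ 3 ⟧ < c → value c t₁ + value c t₂ ≡ ⟪ s ⟫ c →
                     EdgeParity t₁ t₂ s → parity t₁ ≡ parity t₂
EdgeParity⇒≡parity _ _ (inj₁ same) = same
EdgeParity⇒≡parity {c} {t₁} {t₂} {s} 3<c sum≡ (inj₂ noRoot) =
  ⊥-elim (noRootAbove⇒≢0 (affine t₁ +ᵃ affine t₂ -ᵃ s) noRoot 3<c (begin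
    ⟪ affine t₁ +ᵃ affine t₂ -ᵃ s ⟫ c
      ≡⟨ ⟪+ᵃ-ᵃ⟫ (affine t₁) (affine t₂) s c ⟩
    (⟪ affine t₁ ⟫ c + ⟪ affine t₂ ⟫ c) - ⟪ s ⟫ c
      ≡⟨ cong (_- ⟪ s ⟫ c) (sym (cong₂ _+_ (value≡⟪affine⟫ c t₁) (value≡⟪affine⟫ c t₂))) ⟩
    (value c t₁ + value c t₂) - ⟪ s ⟫ c
      ≡⟨ cong (_- ⟪ s ⟫ c) sum≡ ⟩
    ⟪ s ⟫ c - ⟪ s ⟫ c
      ≡⟨ +-inverseʳ (⟪ s ⟫ c) ⟩
    0ℚ ∎))
  where open ≡-Reasoning

Reach-invariant : ∀ {nA nB} {G : Graph nA nB} {M₁ M₂ : Matching G} {X : Set} (f : Vertex nA nB → X) →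
                  (∀ a b → SymDiff M₁ M₂ a b → f (inj₁ a) ≡ f (inj₂ b)) →
                  ∀ {u v} → Reach M₁ M₂ u v → f v ≡ f u
Reach-invariant f f-edge here                 = refl
Reach-invariant f f-edge (stepAB a b u⇝a a~b) = trans (sym (f-edge a b a~b)) (Reach-invariant f f-edge u⇝a)
Reach-invariant f f-edge (stepBA a b u⇝b a~b) = trans (f-edge a b a~b) (Reach-invariant f f-edge u⇝b)

SymDiff⇒matched : ∀ {nA nB} {G : Graph nA nB} {M₁ M₂ : Matching G} {a b} →
                  SymDiff M₁ M₂ a b → mA M₁ a ≡ just b ⊎ mA M₂ a ≡ just b
SymDiff⇒matched = ⊎-map proj₁ proj₁

odd-or-even : ∀ {V : Set} {R : V → Set} {c : ℚ} {y : V → ℚ} p → (∀ v → R v → Class p c (y v)) →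
              (∀ v → R v → OddVal c (y v)) ⊎ (∀ v → R v → EvenVal c (y v))
odd-or-even odd  class = inj₁ class
odd-or-even even class = inj₂ class

module _ {nA nB : ℕ} {c : ℚ} (3<c : ⟦ 3 ⟧ < c) (y : Vertex nA nB → ℚ)
         (niceA : ∀ a → NiceA c (y (inj₁ a))) (niceB : ∀ b → NiceB c (y (inj₂ b))) where

  levelA : Fin nA → Level
  levelA a = proj₁ (find (niceA-level (niceA a)))

  levelB : Fin nB → Level
  levelB b = proj₁ (find (niceB-level (niceB b)))

  level : Vertex nA nB → Level
  level (inj₁ a) = levelA a
  level (inj₂ b) = levelB b

  y≡value∘level : ∀ v → y v ≡ value c (level v)
  y≡value∘level (inj₁ a) = let (_ , _ , y≡) = find (niceA-level (niceA a)) in y≡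
  y≡value∘level (inj₂ b) = let (_ , _ , y≡) = find (niceB-level (niceB b)) in y≡

  level-class : ∀ v → Class (parity (level v)) c (y v)
  level-class v = subst (Class (parity (level v)) c) (sym (y≡value∘level v)) (value-class c (level v))

  tight-edge-parity : ∀ a b → VoteValuedSum c y a b →
                      parity (levelA a) ≡ parity (levelB b)
  tight-edge-parity a b tight =
    let (_ , a∈ , _) = find (niceA-level (niceA a))
        (_ , b∈ , _) = find (niceB-level (niceB b))
        (_ , s∈ , sum≡) = find tight
        value-sum≡ = trans (cong₂ _+_ (sym (y≡value∘level (inj₁ a))) (sym (y≡value∘level (inj₂ b)))) sum≡
    in EdgeParity⇒≡parity 3<c value-sum≡ (edgeParity-holds a∈ b∈ s∈)

  component-class : ∀ {G : Graph nA nB} {M₁ M₂ : Matching G} →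
    (∀ a b → SymDiff M₁ M₂ a b → VoteValuedSum c y a b) → ∀ u →
    (∀ v → Reach M₁ M₂ u v → OddVal c (y v)) ⊎ (∀ v → Reach M₁ M₂ u v → EvenVal c (y v))
  component-class {M₁ = M₁} {M₂} tight u = odd-or-even (parity (level u)) λ v u⇝v →
    subst (λ p → Class p c (y v)) (Reach-invariant (parity ∘ level) parity-edge u⇝v) (level-class v)
    where
    parity-edge : ∀ a b → SymDiff M₁ M₂ a b → parity (levelA a) ≡ parity (levelB b)
    parity-edge a b a~b = tight-edge-parity a b (tight a b a~b)

lemma3 : {nA nB : ℕ} (G : Graph nA nB) (c : ℚ) → ⟦ 3 ⟧ < c →
         (M₁ M₂ : Matching G) → Popular G c M₁ → Popular G c M₂ →
         (u : Vertex nA nB) → (y : Vertex nA nB → ℚ) →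
         (NiceWitness G c M₁ y ⊎ NiceWitness G c M₂ y) →
         (∀ v → Reach M₁ M₂ u v → OddVal c (y v)) ⊎ (∀ v → Reach M₁ M₂ u v → EvenVal c (y v))
lemma3 G c 3<c M₁ M₂ popular₁ popular₂ u y (inj₁ (W , niceA , niceB)) =
  component-class 3<c y niceA niceB
    (λ a b a~b → tight-on-union W M₂ popular₂ (SymDiff⇒matched {M₁ = M₁} {M₂} a~b)) u
lemma3 G c 3<c M₁ M₂ popular₁ popular₂ u y (inj₂ (W , niceA , niceB)) =
  component-class 3<c y niceA niceB
    (λ a b a~b → tight-on-union W M₁ popular₁ (swap (SymDiff⇒matched {M₁ = M₁} {M₂} a~b))) u
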